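{- Let $r,n\ge1$ be integers, $c,d\in\mathbb{Z}$, $\mathscr{d}_1=\gcd(c-d,n)$, $\mathscr{d}_2=\gcd(c+(r-1)d,n)$, and $\rho=(r-1,\dots,2,1,0)$. Consider the map $\theta_{\boldsymbol{z}}$ from the Whittaker space $\mathfrak{W}$ (with basis indexed by cosets $\boldsymbol{\nu}+\Lambda_{fin}$ in $(\mathbb{Z}/n\mathbb{Z})^r/\Lambda_{fin}$) to $V_+(z_1)\otimes\cdots\otimes V_+(z_r)$ (with basis indexed by $(\mathbb{Z}/(n/\mathscr{d}_1)\mathbb{Z})^r$) sending the basis vector indexed by a chosen representative $\boldsymbol{\nu}\in(\mathbb{Z}/n\mathbb{Z})^r$ to the basis vector indexed by $\rho-\boldsymbol{\nu}\pmod{n/\mathscr{d}_1}$ (componentwise). Then $\theta_{\boldsymbol{z}}$ is well-defined independently of the choice of coset representatives (equivalently, $\boldsymbol{\nu}\mapsto\rho-\boldsymbol{\nu}\bmod n/\mathscr{d}_1$ is constant on cosets of $\Lambda_{fin}$) if and only if \[\gcd\left(\mathscr{d}_2,\frac{dn}{\mathscr{d}_1}\right)=\gcd(c,d,n).\]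
   Context: $B_{c,d}$ is the $r\times r$ matrix with diagonal entries $c$ and off-diagonal entries $d$, and $\Lambda_{fin}=\{\boldsymbol{x}\in(\mathbb{Z}/n\mathbb{Z})^r:B_{c,d}\boldsymbol{x}\equiv\boldsymbol{0}\pmod n\}$. $\mathfrak{W}=\mathfrak{W}^{\boldsymbol{z}}$ is the space of Whittaker functions on the principal series representation with Satake parameters $\boldsymbol{z}=(z_1,\dots,z_r)\in\mathbb{C}^r$ of the $n$-fold metaplectic cover of $GL_r(F)$ attached to $B_{c,d}$; its basis is indexed by $\widetilde{T}/H\cong(\mathbb{Z}/n\mathbb{Z})^r/\Lambda_{fin}$. $V_+(z)$ is the $n/\mathscr{d}_1$-dimensional evaluation module of the quantum affine algebra $U_q(\widehat{\mathfrak{gl}}(n/\mathscr{d}_1))$, with basis indexed by $\mathbb{Z}/(n/\mathscr{d}_1)\mathbb{Z}$. -}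

module Defs where

open import Data.Nat as ℕ using (ℕ; suc; _∸_)
open import Data.Nat.GCD using (gcd; gcd[m,n]∣n)
open import Data.Nat.Divisibility using (quotient)
open import Data.Integer as ℤ using (ℤ; +_; ∣_∣; _-_)
open import Data.Integer.Divisibility using (_∣_)
open import Data.Fin using (Fin; toℕ; _≟_)
open import Data.List using (List; foldr; map; allFin)
open import Relation.Nullary using (yes; no)

Σℤ : (r : ℕ) → (Fin r → ℤ) → ℤ
Σℤ r f = foldr ℤ._+_ (+ 0) (map f (allFin r))

B : ℤ → ℤ → {r : ℕ} → Fin r → Fin r → ℤ
B c d i j with i ≟ j
... | yes _ = c
... | no  _ = d

Bmul : ℤ → ℤ → (r : ℕ) → (Fin r → ℤ) → Fin r → ℤ
Bmul c d r x i = Σℤ r (λ j → B c d i j ℤ.* x j)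

_≡_[mod_] : ℤ → ℤ → ℕ → Set
a ≡ b [mod m ] = + m ∣ (a - b)

InΛfin : ℤ → ℤ → (r n : ℕ) → (Fin r → ℤ) → Set
InΛfin c d r n x = ∀ i → Bmul c d r x i ≡ + 0 [mod n ]

-- residues in Z/nZ represented by Fin n; lift to integers
lift : {n : ℕ} → Fin n → ℤ
lift a = + toℕ a

𝒹₁ : ℤ → ℤ → ℕ → ℕ
𝒹₁ c d n = gcd ∣ c - d ∣ n

𝒹₂ : ℤ → ℤ → ℕ → ℕ → ℕ
𝒹₂ c d r n = gcd ∣ c ℤ.+ (+ (r ∸ 1)) ℤ.* d ∣ n

n/𝒹₁ : ℤ → ℤ → ℕ → ℕ
n/𝒹₁ c d n = quotient (gcd[m,n]∣n ∣ c - d ∣ n)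

ρ : (r : ℕ) → Fin r → ℤ
ρ r i = + (r ∸ suc (toℕ i))

θWellDefined : ℤ → ℤ → (r n : ℕ) → Set
θWellDefined c d r n =
  (ν μ : Fin r → Fin n) →
  InΛfin c d r n (λ j → lift (ν j) - lift (μ j)) →
  ∀ i → (ρ r i - lift (ν i)) ≡ (ρ r i - lift (μ i)) [mod n/𝒹₁ c d n ]

gcd3 : ℤ → ℤ → ℕ → ℕ
gcd3 c d n = gcd (gcd ∣ c ∣ ∣ d ∣) n

-- With integer representatives, B_{c,d} x = (c - d) x + d (Σ x) 𝟙, so θ is well defined iff every
-- x ∈ Λ_fin has all coordinates divisible by m = n/𝒹₁. Put e = c + (r - 1) d, so that e Σx is the
-- coordinate sum of B x, and G = gcd(𝒹₂, d m). For x ∈ Λ_fin, n divides (Σx) e and, multiplying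
-- the first row by m and using n ∣ (c - d) m, also (Σx) d m; hence n ∣ (Σx) G. If G ∣ d this leaves
-- n ∣ (c - d) xᵢ, i.e. m ∣ xᵢ. Conversely, writing e = ε G' and d m = κ G' with G' = gcd(e, d m),
-- the vector (κ - m ε, κ, …, κ) lies in Λ_fin, so m ∣ κ, whence G' ∣ d and G ∣ d. Finally G ∣ d is
-- equivalent to G = gcd(c, d, n): the latter always divides G, and G divides e and n.

module Submission where

open import Defs
open import Data.Nat using (ℕ; _≥_)
open import Data.Nat.GCD using (gcd)
open import Data.Integer using (ℤ; ∣_∣; +_; _*_)
open import Relation.Binary.PropositionalEquality using (_≡_)
open import Function.Bundles using (_⇔_)

open import Data.Nat as ℕ using (zero; suc)
import Data.Nat.Properties as ℕ
import Data.Nat.GCD as ℕ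
import Data.Nat.Divisibility as ℕ using (_∣_; divides; m∣n⇒n≡quotient*m; ∣-antisym)
open import Data.Integer using (_+_; _-_; -_)
import Data.Integer.Properties as ℤ
import Data.Integer.GCD as ℤ
open import Data.Integer.DivMod using (_%ℕ_; _/ℕ_; n%ℕd<d; a≡a%ℕn+[a/ℕn]*n)
open import Data.Integer.Divisibility.Signed
open import Data.Integer.Tactic.RingSolver using (solve-∀)
open import Data.Fin as Fin using (Fin; zero; suc; toℕ; fromℕ<)
open import Data.Fin.Properties using (toℕ-fromℕ<)
open import Data.List using (foldr; tabulate)
open import Data.List.Properties using (map-tabulate)
open import Data.Vec.Functional using (Vector)
open import Algebra.Properties.CommutativeMonoid.Sum ℤ.+-0-commutativeMonoid
  using (sum; sum-cong-≗; ∑-distrib-+)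
open import Algebra.Properties.Semiring.Sum ℤ.+-*-semiring using (*-distribˡ-sum)
open import Function using (_∘_; id)
open import Function.Bundles using (mk⇔)
open import Function.Properties.Equivalence using () renaming (trans to ⇔-trans)
open import Relation.Binary.PropositionalEquality
  using (refl; sym; trans; cong; cong₂; subst; subst₂; module ≡-Reasoning)
open import Relation.Nullary using (yes; no)
open import Data.Sum using (inj₂)

Σℤ≡sum : ∀ r (f : Fin r → ℤ) → Σℤ r f ≡ sum f
Σℤ≡sum r f = trans (cong (foldr _+_ (+ 0)) (map-tabulate id f)) (foldr-tabulate r f)
  where
  foldr-tabulate : ∀ r (f : Fin r → ℤ) → foldr _+_ (+ 0) (tabulate f) ≡ sum f
  foldr-tabulate zero    f = refl
  foldr-tabulate (suc r) f = cong (_+_ (f zero)) (foldr-tabulate r (f ∘ suc))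

sum-const : ∀ r k → sum {r} (λ _ → k) ≡ + r * k
sum-const zero    k = refl
sum-const (suc r) k = trans (cong (_+_ k) (sum-const r k)) (lemma k (+ r))
  where
  lemma : ∀ k r → k + r * k ≡ (+ 1 + r) * k
  lemma = solve-∀

∣sum : ∀ {k r} (f : Vector ℤ r) → (∀ i → k ∣ f i) → k ∣ sum f
∣sum {r = zero}  f k∣f = divides (+ 0) refl
∣sum {r = suc r} f k∣f = ∣m∣n⇒∣m+n (k∣f zero) (∣sum (f ∘ suc) (k∣f ∘ suc))

B-suc : ∀ c d {r} (i j : Fin r) → B c d (suc i) (suc j) ≡ B c d i j
B-suc c d i j with i Fin.≟ j
... | yes _ = refl
... | no  _ = refl

Bmul≡diag+rank1 : ∀ c d r (x : Vector ℤ r) i → Bmul c d r x i ≡ (c - d) * x i + d * sum x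
Bmul≡diag+rank1 c d r x i = trans (Σℤ≡sum r _) (go r x i)
  where
  open ≡-Reasoning
  go : ∀ r (x : Vector ℤ r) i → sum (λ j → B c d i j * x j) ≡ (c - d) * x i + d * sum x
  go (suc r) x zero = begin
    c * x zero + sum (λ j → d * x (suc j))  ≡⟨ cong (_+_ (c * x zero)) (*-distribˡ-sum d (x ∘ suc)) ⟨
    c * x zero + d * sum (x ∘ suc)          ≡⟨ lemma c d (x zero) (sum (x ∘ suc)) ⟩
    (c - d) * x zero + d * sum x            ∎
    where
    lemma : ∀ c d x₀ s → c * x₀ + d * s ≡ (c - d) * x₀ + d * (x₀ + s)
    lemma = solve-∀
  go (suc r) x (suc i) = begin
    d * x zero + sum (λ j → B c d (suc i) (suc j) * x (suc j))
      ≡⟨ cong (_+_ (d * x zero)) (sum-cong-≗ (λ j → cong (_* x (suc j)) (B-suc c d i j))) ⟩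
    d * x zero + sum (λ j → B c d i j * x (suc j))
      ≡⟨ cong (_+_ (d * x zero)) (go r (x ∘ suc) i) ⟩
    d * x zero + ((c - d) * x (suc i) + d * sum (x ∘ suc))
      ≡⟨ lemma (c - d) d (x zero) (x (suc i)) (sum (x ∘ suc)) ⟩
    (c - d) * x (suc i) + d * sum x ∎
    where
    lemma : ∀ a d x₀ xᵢ s → d * x₀ + (a * xᵢ + d * s) ≡ a * xᵢ + d * (x₀ + s)
    lemma = solve-∀

Bmul-+-* : ∀ c d r (x w : Vector ℤ r) k i →
           Bmul c d r (λ j → x j + k * w j) i ≡ Bmul c d r x i + k * Bmul c d r w i
Bmul-+-* c d r x w k i = begin
  Bmul c d r (λ j → x j + k * w j) i
    ≡⟨ Σℤ≡sum r _ ⟩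
  sum (λ j → Bᵢ j * (x j + k * w j))
    ≡⟨ sum-cong-≗ (λ j → lemma (Bᵢ j) (x j) k (w j)) ⟩
  sum (λ j → Bᵢ j * x j + k * (Bᵢ j * w j))
    ≡⟨ ∑-distrib-+ (λ j → Bᵢ j * x j) (λ j → k * (Bᵢ j * w j)) ⟩
  sum (λ j → Bᵢ j * x j) + sum (λ j → k * (Bᵢ j * w j))
    ≡⟨ cong (_+_ (sum (λ j → Bᵢ j * x j))) (*-distribˡ-sum k (λ j → Bᵢ j * w j)) ⟨
  sum (λ j → Bᵢ j * x j) + k * sum (λ j → Bᵢ j * w j)
    ≡⟨ cong₂ (λ u v → u + k * v) (Σℤ≡sum r _) (Σℤ≡sum r _) ⟨
  Bmul c d r x i + k * Bmul c d r w i ∎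
  where
  open ≡-Reasoning
  Bᵢ : Fin r → ℤ
  Bᵢ = B c d i
  lemma : ∀ b x k w → b * (x + k * w) ≡ b * x + k * (b * w)
  lemma = solve-∀

sum-Bmul : ∀ c d r (x : Vector ℤ r) → sum (Bmul c d r x) ≡ ((c - d) + + r * d) * sum x
sum-Bmul c d r x = begin
  sum (Bmul c d r x)
    ≡⟨ sum-cong-≗ (Bmul≡diag+rank1 c d r x) ⟩
  sum (λ i → (c - d) * x i + d * sum x)
    ≡⟨ ∑-distrib-+ {r} (λ i → (c - d) * x i) (λ _ → d * sum x) ⟩
  sum (λ i → (c - d) * x i) + sum {r} (λ _ → d * sum x)
    ≡⟨ cong₂ _+_ (*-distribˡ-sum (c - d) x) (sym (sum-const r (d * sum x))) ⟨
  (c - d) * sum x + + r * (d * sum x)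
    ≡⟨ lemma (c - d) d (+ r) (sum x) ⟩
  ((c - d) + + r * d) * sum x ∎
  where
  open ≡-Reasoning
  lemma : ∀ a d r s → a * s + r * (d * s) ≡ (a + r * d) * s
  lemma = solve-∀

≡0-mod⇒∣ : ∀ {a n} → a ≡ + 0 [mod n ] → + n ∣ a
≡0-mod⇒∣ {a} {n} a≡0 = subst (+ n ∣_) (ℤ.+-identityʳ a) (∣ᵤ⇒∣ a≡0)

∣⇒≡0-mod : ∀ {a n} → + n ∣ a → a ≡ + 0 [mod n ]
∣⇒≡0-mod {a} {n} n∣a = ∣⇒∣ᵤ (subst (+ n ∣_) (sym (ℤ.+-identityʳ a)) n∣a)

-[[p-u]-[p-v]]≡u-v : ∀ p u v → - ((p - u) - (p - v)) ≡ u - v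
-[[p-u]-[p-v]]≡u-v = solve-∀

p-u≡p-v⇒m∣u-v : ∀ p u v {m} → (p - u) ≡ (p - v) [mod m ] → + m ∣ u - v
p-u≡p-v⇒m∣u-v p u v {m} h = subst (+ m ∣_) (-[[p-u]-[p-v]]≡u-v p u v) (∣m⇒∣-m (∣ᵤ⇒∣ h))

m∣u-v⇒p-u≡p-v : ∀ p u v {m} → + m ∣ u - v → (p - u) ≡ (p - v) [mod m ]
m∣u-v⇒p-u≡p-v p u v {m} h =
  ∣⇒∣ᵤ (subst (+ m ∣_) (ℤ.neg-involutive _)
              (∣m⇒∣-m (subst (+ m ∣_) (sym (-[[p-u]-[p-v]]≡u-v p u v)) h)))

InΛfin-+-* : ∀ {c d r n x} (w : Vector ℤ r) →
             InΛfin c d r n x → InΛfin c d r n (λ j → x j + + n * w j)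
InΛfin-+-* {c} {d} {r} {n} {x} w x∈Λ i = ∣⇒≡0-mod (subst (+ n ∣_) (sym (Bmul-+-* c d r x w (+ n) i))
  (∣m∣n⇒∣m+n (≡0-mod⇒∣ {Bmul c d r x i} (x∈Λ i)) (∣m⇒∣m*n (Bmul c d r w i) ∣-refl)))

InΛfin-cong : ∀ {c d r n x y} → (∀ j → x j ≡ y j) → InΛfin c d r n x → InΛfin c d r n y
InΛfin-cong {c} {d} {r} {n} {x} {y} x≗y x∈Λ i = subst (_≡ + 0 [mod n ]) Bx≡By (x∈Λ i)
  where
  Bx≡By : Bmul c d r x i ≡ Bmul c d r y i
  Bx≡By = trans (Σℤ≡sum r _)
                (trans (sum-cong-≗ (λ j → cong (B c d i j *_) (x≗y j))) (sym (Σℤ≡sum r _)))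

residue : ∀ n .{{_ : ℕ.NonZero n}} → ℤ → Fin n
residue n x = fromℕ< (n%ℕd<d x n)

lift-residue : ∀ n .{{_ : ℕ.NonZero n}} x → lift (residue n x) ≡ x + + n * - (x /ℕ n)
lift-residue n x = begin
  + toℕ (residue n x)
    ≡⟨ cong +_ (toℕ-fromℕ< (n%ℕd<d x n)) ⟩
  + (x %ℕ n)
    ≡⟨ lemma (+ (x %ℕ n)) (x /ℕ n) (+ n) ⟩
  (+ (x %ℕ n) + x /ℕ n * + n) + + n * - (x /ℕ n)
    ≡⟨ cong (λ t → t + + n * - (x /ℕ n)) (a≡a%ℕn+[a/ℕn]*n x n) ⟨
  x + + n * - (x /ℕ n) ∎
  where
  open ≡-Reasoning
  lemma : ∀ ρ q n → ρ ≡ (ρ + q * n) + n * - q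
  lemma = solve-∀

∣*gcd : ∀ {k} s u v → k ∣ s * u → k ∣ s * v → k ∣ s * ℤ.gcd u v
∣*gcd {k} s u v k∣su k∣sv = ∣ᵤ⇒∣ (subst (∣ k ∣ ℕ.∣_) ∣s∣*gcd≡∣s*gcd∣
  (ℕ.gcd-greatest (subst (∣ k ∣ ℕ.∣_) (ℤ.abs-* s u) (∣⇒∣ᵤ k∣su))
                  (subst (∣ k ∣ ℕ.∣_) (ℤ.abs-* s v) (∣⇒∣ᵤ k∣sv))))
  where
  ∣s∣*gcd≡∣s*gcd∣ : ℕ.gcd (∣ s ∣ ℕ.* ∣ u ∣) (∣ s ∣ ℕ.* ∣ v ∣) ≡ ∣ s * ℤ.gcd u v ∣
  ∣s∣*gcd≡∣s*gcd∣ = trans (sym (ℕ.c*gcd[m,n]≡gcd[cm,cn] (∣ s ∣) (∣ u ∣) (∣ v ∣)))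
                          (sym (ℤ.abs-* s (ℤ.gcd u v)))

gcd∣ˡ : ∀ u v → ℤ.gcd u v ∣ u
gcd∣ˡ u v = ∣ᵤ⇒∣ (ℤ.gcd[i,j]∣i u v)

gcd∣ʳ : ∀ u v → ℤ.gcd u v ∣ v
gcd∣ʳ u v = ∣ᵤ⇒∣ (ℤ.gcd[i,j]∣j u v)

∣gcd : ∀ {k u v} → k ∣ u → k ∣ v → k ∣ ℤ.gcd u v
∣gcd {k} {u} {v} k∣u k∣v = ∣ᵤ⇒∣ (ℤ.gcd-greatest {u} {v} {k} (∣⇒∣ᵤ k∣u) (∣⇒∣ᵤ k∣v))

∣a*x⇒n/gcd∣x : ∀ {n} .{{_ : ℕ.NonZero n}} a x q → n ≡ q ℕ.* gcd ∣ a ∣ n → + n ∣ a * x → + q ∣ x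
∣a*x⇒n/gcd∣x {n} a x q n≡q*g n∣ax = *-cancelʳ-∣ (+ g) {{g≢0}} (subst (_∣ x * + g) +n≡q*g n∣xg)
  where
  g = gcd ∣ a ∣ n
  g≢0 = ℕ.≢-nonZero (ℕ.gcd[m,n]≢0 (∣ a ∣) n (inj₂ (ℕ.≢-nonZero⁻¹ n)))
  +n≡q*g : + n ≡ + q * + g
  +n≡q*g = trans (cong +_ n≡q*g) (ℤ.pos-* q g)
  n∣xg : + n ∣ x * + g
  n∣xg = ∣*gcd x a (+ n) (subst (+ n ∣_) (ℤ.*-comm a x) n∣ax) (∣n⇒∣m*n x ∣-refl)

module Setting (r' n' : ℕ) (c d : ℤ) where

  r n : ℕ
  r = suc r'
  n = suc n'

  a e : ℤ
  a = c - d
  e = c + + r' * d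

  d₁ m d₂ : ℕ
  d₁ = 𝒹₁ c d n
  m = n/𝒹₁ c d n
  d₂ = 𝒹₂ c d r n

  dm : ℤ
  dm = d * + m

  G g : ℕ
  G = gcd d₂ ∣ dm ∣
  g = gcd3 c d n

  n≡m*d₁ : n ≡ m ℕ.* d₁
  n≡m*d₁ = ℕ.m∣n⇒n≡quotient*m (ℕ.gcd[m,n]∣n ∣ a ∣ n)

  instance
    m≢0 : ℕ.NonZero m
    m≢0 = ℕ.m*n≢0⇒m≢0 m {{subst ℕ.NonZero n≡m*d₁ _}}

  m∣n : + m ∣ + n
  m∣n = ∣ᵤ⇒∣ (ℕ.divides d₁ (trans n≡m*d₁ (ℕ.*-comm m d₁)))

  n∣a*m : + n ∣ a * + m
  n∣a*m = subst (_∣ a * + m) d₁*m≡n (*-monoˡ-∣ (+ m) (gcd∣ˡ a (+ n)))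
    where
    d₁*m≡n : + d₁ * + m ≡ + n
    d₁*m≡n = trans (sym (ℤ.pos-* d₁ m)) (cong +_ (trans (ℕ.*-comm d₁ m) (sym n≡m*d₁)))

  e≡a+r*d : e ≡ a + + r * d
  e≡a+r*d = lemma c d (+ r')
    where
    lemma : ∀ c d r' → c + r' * d ≡ (c - d) + (+ 1 + r') * d
    lemma = solve-∀

  G∣e : + G ∣ e
  G∣e = ∣-trans (gcd∣ˡ (+ d₂) dm) (gcd∣ˡ e (+ n))

  G∣n : + G ∣ + n
  G∣n = ∣-trans (gcd∣ˡ (+ d₂) dm) (gcd∣ʳ e (+ n))

  G∣dm : + G ∣ dm
  G∣dm = gcd∣ʳ (+ d₂) dm

  G∣d⇔G≡g : + G ∣ d ⇔ G ≡ g
  G∣d⇔G≡g = mk⇔ (λ G∣d → ℕ.∣-antisym (∣⇒∣ᵤ (G∣g G∣d)) (∣⇒∣ᵤ g∣G))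
                (λ G≡g → subst (λ t → + t ∣ d) (sym G≡g) g∣d)
    where
    g∣c : + g ∣ c
    g∣c = ∣-trans (gcd∣ˡ (ℤ.gcd c d) (+ n)) (gcd∣ˡ c d)
    g∣d : + g ∣ d
    g∣d = ∣-trans (gcd∣ˡ (ℤ.gcd c d) (+ n)) (gcd∣ʳ c d)
    g∣G : + g ∣ + G
    g∣G = ∣gcd (∣gcd (∣m∣n⇒∣m+n g∣c (∣n⇒∣m*n (+ r') g∣d)) (gcd∣ʳ (ℤ.gcd c d) (+ n)))
               (∣m⇒∣m*n (+ m) g∣d)
    c≡e-r'*d : c ≡ e - + r' * d
    c≡e-r'*d = lemma c d (+ r')
      where
      lemma : ∀ c d r' → c ≡ (c + r' * d) - r' * d
      lemma = solve-∀
    G∣g : + G ∣ d → + G ∣ + g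
    G∣g G∣d = ∣gcd (∣gcd G∣c G∣d) G∣n
      where
      G∣c : + G ∣ c
      G∣c = subst (+ G ∣_) (sym c≡e-r'*d) (∣m∣n⇒∣m-n G∣e (∣n⇒∣m*n (+ r') G∣d))

  ΛfinDivisible : Set
  ΛfinDivisible = ∀ x → InΛfin c d r n x → ∀ i → + m ∣ x i

  G∣d⇒ΛfinDivisible : + G ∣ d → ΛfinDivisible
  G∣d⇒ΛfinDivisible G∣d x x∈Λ i = ∣a*x⇒n/gcd∣x a (x i) m n≡m*d₁ n∣a*xᵢ
    where
    S = sum x
    n∣Bx : ∀ j → + n ∣ Bmul c d r x j
    n∣Bx j = ≡0-mod⇒∣ {Bmul c d r x j} (x∈Λ j)
    n∣ax+dS : ∀ j → + n ∣ a * x j + d * S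
    n∣ax+dS j = subst (+ n ∣_) (Bmul≡diag+rank1 c d r x j) (n∣Bx j)
    n∣S*e : + n ∣ S * e
    n∣S*e = subst (+ n ∣_) (trans (sum-Bmul c d r x) (trans (cong (_* S) (sym e≡a+r*d)) (ℤ.*-comm e S)))
                  (∣sum (Bmul c d r x) n∣Bx)
    m*[ax+dS] : ∀ a x d S m → m * (a * x + d * S) ≡ (a * m) * x + S * (d * m)
    m*[ax+dS] = solve-∀
    n∣S*dm : + n ∣ S * dm
    n∣S*dm = ∣m+n∣m⇒∣n
      (subst (+ n ∣_) (m*[ax+dS] a (x zero) d S (+ m)) (∣n⇒∣m*n (+ m) (n∣ax+dS zero)))
      (∣m⇒∣m*n (x zero) n∣a*m)
    n∣S*G : + n ∣ S * + G
    n∣S*G = ∣*gcd S (+ d₂) dm (∣*gcd S e (+ n) n∣S*e (∣n⇒∣m*n S ∣-refl)) n∣S*dm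
    n∣a*xᵢ : + n ∣ a * x i
    n∣a*xᵢ = ∣m+n∣n⇒∣m (n∣ax+dS i)
                        (subst (+ n ∣_) (ℤ.*-comm S d) (∣-trans n∣S*G (*-monoʳ-∣ S G∣d)))

  witness : ℤ → ℤ → Vector ℤ r
  witness κ ε zero    = κ - + m * ε
  witness κ ε (suc _) = κ

  witness∈Λfin : ∀ κ ε → e * κ ≡ dm * ε → InΛfin c d r n (witness κ ε)
  witness∈Λfin κ ε eκ≡dmε i = ∣⇒≡0-mod (subst (+ n ∣_) (sym (Bmul-witness i)) (n∣ i))
    where
    open ≡-Reasoning
    S = sum (witness κ ε)
    S≡ : S ≡ (κ - + m * ε) + + r' * κ
    S≡ = cong (_+_ (κ - + m * ε)) (sum-const r' κ)
    eκ-dmε≡0 : e * κ - dm * ε ≡ + 0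
    eκ-dmε≡0 = trans (cong (_- dm * ε) eκ≡dmε) (ℤ.+-inverseʳ (dm * ε))
    residual : Vector ℤ r
    residual zero    = (a * + m) * - ε + (e * κ - dm * ε)
    residual (suc _) = e * κ - dm * ε
    lemma₀ : ∀ c d r' κ m ε → (c - d) * (κ - m * ε) + d * ((κ - m * ε) + r' * κ)
                             ≡ ((c - d) * m) * - ε + ((c + r' * d) * κ - (d * m) * ε)
    lemma₀ = solve-∀
    lemma₁ : ∀ c d r' κ m ε → (c - d) * κ + d * ((κ - m * ε) + r' * κ)
                             ≡ (c + r' * d) * κ - (d * m) * ε
    lemma₁ = solve-∀
    Bmul-witness : ∀ i → Bmul c d r (witness κ ε) i ≡ residual i
    Bmul-witness zero = begin
      Bmul c d r (witness κ ε) zero            ≡⟨ Bmul≡diag+rank1 c d r (witness κ ε) zero ⟩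
      a * (κ - + m * ε) + d * S                ≡⟨ cong (λ t → a * (κ - + m * ε) + d * t) S≡ ⟩
      a * (κ - + m * ε) + d * ((κ - + m * ε) + + r' * κ) ≡⟨ lemma₀ c d (+ r') κ (+ m) ε ⟩
      residual zero                            ∎
    Bmul-witness (suc j) = begin
      Bmul c d r (witness κ ε) (suc j)         ≡⟨ Bmul≡diag+rank1 c d r (witness κ ε) (suc j) ⟩
      a * κ + d * S                            ≡⟨ cong (λ t → a * κ + d * t) S≡ ⟩
      a * κ + d * ((κ - + m * ε) + + r' * κ)   ≡⟨ lemma₁ c d (+ r') κ (+ m) ε ⟩
      residual (suc j)                         ∎
    n∣0 : + n ∣ e * κ - dm * ε
    n∣0 = subst (+ n ∣_) (sym eκ-dmε≡0) (divides (+ 0) refl)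
    n∣ : ∀ i → + n ∣ residual i
    n∣ zero    = ∣m∣n⇒∣m+n (∣m⇒∣m*n (- ε) n∣a*m) n∣0
    n∣ (suc _) = n∣0

  ΛfinDivisible⇒G∣d : ΛfinDivisible → + G ∣ d
  ΛfinDivisible⇒G∣d divisible = ∣-trans (∣gcd G∣e G∣dm) G'∣d
    where
    G' = ℤ.gcd e dm
    ε κ : ℤ
    ε = _∣_.quotient (gcd∣ˡ e dm)
    κ = _∣_.quotient (gcd∣ʳ e dm)
    e≡εG' : e ≡ ε * G'
    e≡εG' = _∣_.equality (gcd∣ˡ e dm)
    dm≡κG' : dm ≡ κ * G'
    dm≡κG' = _∣_.equality (gcd∣ʳ e dm)
    eκ≡dmε : e * κ ≡ dm * ε
    eκ≡dmε = begin
      e * κ        ≡⟨ cong (_* κ) e≡εG' ⟩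
      ε * G' * κ   ≡⟨ lemma ε G' κ ⟩
      κ * G' * ε   ≡⟨ cong (_* ε) dm≡κG' ⟨
      dm * ε       ∎
      where
      open ≡-Reasoning
      lemma : ∀ ε G κ → ε * G * κ ≡ κ * G * ε
      lemma = solve-∀
    m∣κ : + m ∣ κ
    m∣κ = subst (+ m ∣_) (lemma κ (+ m) ε)
            (∣m∣n⇒∣m+n (divisible (witness κ ε) (witness∈Λfin κ ε eκ≡dmε) zero)
                       (∣m⇒∣m*n ε ∣-refl))
      where
      lemma : ∀ κ m ε → (κ - m * ε) + m * ε ≡ κ
      lemma = solve-∀
    G'∣d : G' ∣ d
    G'∣d = *-cancelʳ-∣ (+ m) (subst₂ _∣_ (ℤ.*-comm (+ m) G') (sym dm≡κG') (*-monoˡ-∣ G' m∣κ))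

  θWellDefined⇔ΛfinDivisible : θWellDefined c d r n ⇔ ΛfinDivisible
  θWellDefined⇔ΛfinDivisible = mk⇔ to from
    where
    from : ΛfinDivisible → θWellDefined c d r n
    from divisible ν μ ν-μ∈Λ i =
      m∣u-v⇒p-u≡p-v (ρ r i) (lift (ν i)) (lift (μ i)) (divisible _ ν-μ∈Λ i)

    to : θWellDefined c d r n → ΛfinDivisible
    to wd x x∈Λ i = ∣m+n∣n⇒∣m (subst (+ m ∣_) (ν-μ≡x+n*w i) m∣ν-μ) (∣m⇒∣m*n (w i) m∣n)
      where
      ν μ : Fin r → Fin n
      ν j = residue n (x j)
      μ _ = zero
      w : Vector ℤ r
      w j = - (x j /ℕ n)
      ν-μ≡x+n*w : ∀ j → lift (ν j) - lift (μ j) ≡ x j + + n * w j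
      ν-μ≡x+n*w j = trans (ℤ.+-identityʳ (lift (ν j))) (lift-residue n (x j))
      m∣ν-μ : + m ∣ lift (ν i) - lift (μ i)
      m∣ν-μ = p-u≡p-v⇒m∣u-v (ρ r i) (lift (ν i)) (lift (μ i))
                (wd ν μ (InΛfin-cong (sym ∘ ν-μ≡x+n*w) (InΛfin-+-* w x∈Λ)) i)

theorem8p3 : (r n : ℕ) → r ≥ 1 → n ≥ 1 → (c d : ℤ) →
    θWellDefined c d r n ⇔ (gcd (𝒹₂ c d r n) ∣ d * (+ n/𝒹₁ c d n) ∣ ≡ gcd3 c d n)
theorem8p3 (suc r') (suc n') _ _ c d =
  ⇔-trans θWellDefined⇔ΛfinDivisible
    (⇔-trans (mk⇔ ΛfinDivisible⇒G∣d G∣d⇒ΛfinDivisible) G∣d⇔G≡g)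
  where open Setting r' n' c d
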